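{- Let $H$ be a connected bigraph and let $S$ be a non-trivial strong component of $H^+$ containing the vertex $(u,v)$. Then there exist vertices $u',v'$ of $H$ such that $uu',vv'$ are independent edges of $H$, and hence $S$ contains the four vertices $(u,v),(u,v'),(u',v),(u',v')$.
   Context: A bigraph is a bipartite graph $H$ with a fixed bipartition $V(H)=B\cup W$; two vertices have the same colour if they lie in the same part. The pair-digraph $H^+$ has as vertices all ordered pairs $(u,v)$ of distinct vertices of $H$, and arcs: $(u,v)\to(u',v)$ whenever $u,v$ have the same colour, $uu'\in E(H)$ and $vu'\notin E(H)$; and $(u,v)\to(u,v')$ whenever $u,v$ have different colours, $vv'\in E(H)$ and $uv\notin E(H)$. A strong component is non-trivial if it has more than one vertex. Two edges $ab,cd$ of $H$ are independent if the subgraph of $H$ induced by $a,b,c,d$ has exactly the two edges $ab,cd$. -}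

module Defs where

open import Data.Nat using (ℕ)
open import Data.Fin using (Fin)
open import Data.Bool using (Bool; true)
open import Data.Product using (_×_; _,_; ∃; Σ)
open import Relation.Nullary using (¬_)
open import Relation.Binary.PropositionalEquality using (_≡_; _≢_)
open import Relation.Binary.Construct.Closure.ReflexiveTransitive using (Star)

-- A finite simple graph on vertex set Fin n (adjacency as a Bool matrix),
-- together with a fixed bipartition given by a colouring col : Fin n → Bool
-- (the two parts B, W are the two colour classes); every edge joins vertices
-- of different colours.
record Bigraph (n : ℕ) : Set where
  field
    adj       : Fin n → Fin n → Bool
    col       : Fin n → Bool
    adj-sym   : ∀ x y → adj x y ≡ true → adj y x ≡ true
    adj-irr   : ∀ x → ¬ (adj x x ≡ true)
    bipartite : ∀ x y → adj x y ≡ true → col x ≢ col y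

module _ {n : ℕ} (H : Bigraph n) where
  open Bigraph H

  E : Fin n → Fin n → Set
  E x y = adj x y ≡ true

  Connected : Set
  Connected = ∀ x y → Star E x y

  -- Vertices of H⁺: ordered pairs of distinct vertices.
  IsPair : Fin n × Fin n → Set
  IsPair (u , v) = u ≢ v

  data Arc : Fin n × Fin n → Fin n × Fin n → Set where
    left  : ∀ {u v u'} → u ≢ v → u' ≢ v →
            col u ≡ col v → E u u' → ¬ E v u' →
            Arc (u , v) (u' , v)
    right : ∀ {u v v'} → u ≢ v → u ≢ v' →
            col u ≢ col v → E v v' → ¬ E u v →
            Arc (u , v) (u , v')

  Reach : Fin n × Fin n → Fin n × Fin n → Set
  Reach = Star Arc

  SameComp : Fin n × Fin n → Fin n × Fin n → Set
  SameComp p q = Reach p q × Reach q p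

  NontrivialComp : Fin n × Fin n → Set
  NontrivialComp p = IsPair p × ∃ λ q → IsPair q × q ≢ p × SameComp p q

  Independent : Fin n → Fin n → Fin n → Fin n → Set
  Independent a b c d =
    E a b × E c d × ¬ E a c × ¬ E a d × ¬ E b c × ¬ E b d

module Submission where

-- Write p = (u , v).  A non-trivial strong component of H⁺
-- containing p yields a walk p →* z in H⁺ followed by an arc z → p.
-- Looking at the arcs of this closed walk next to p produces the edges:
--  * if the arc into p is a right arc (u , w) → p, then u and v have the
--    same colour, so the first arc out of p is a left arc p → (u₁ , v);
--    the edges uu₁ and vw are independent;
--  * if the arc into p is a left arc (w , v) → p, then the arc entering
--    (w , v) along the walk cannot be a left arc (colours), so it is a
--    right arc (w , x) → (w , v); the edges uw and vx are independent.
-- Conversely, independent edges uu', vv' always close up a directed 4-cycle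
-- on (u,v), (u,v'), (u',v), (u',v') in H⁺, so these four pairs lie in one
-- strong component.

open import Defs
open import Data.Nat using (ℕ)
open import Data.Fin using (Fin)
open import Data.Bool using (Bool; _≟_)
open import Data.Bool.Properties using (¬-not)
open import Data.Product using (_×_; _,_; ∃; ∃₂)
open import Data.Empty using (⊥-elim)
open import Relation.Nullary using (¬_; yes; no)
open import Relation.Binary.PropositionalEquality
  using (_≡_; _≢_; refl; sym; trans; cong)
open import Relation.Binary.Construct.Closure.ReflexiveTransitive
  using (Star; ε; _◅_; _◅◅_)

two-colours : {a b c : Bool} → a ≢ c → b ≢ c → a ≡ b
two-colours a≢c b≢c = trans (¬-not a≢c) (sym (¬-not b≢c))

module _ {A : Set} {R : A → A → Set} where

  first-step : ∀ {x y z} → Star R x y → R y z → ∃ (R x)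
  first-step ε         r = _ , r
  first-step (r ◅ _) _ = _ , r

  last-step-◅ : ∀ {x y z} → R x y → Star R y z → ∃ λ m → Star R x m × R m z
  last-step-◅ r ε = _ , ε , r
  last-step-◅ r (r' ◅ rs) with last-step-◅ r' rs
  ... | m , rs' , r'' = m , r ◅ rs' , r''

  last-step : ∀ {x y} → Star R x y → x ≢ y → ∃ λ m → Star R x m × R m y
  last-step ε         x≢x = ⊥-elim (x≢x refl)
  last-step (r ◅ rs) _   = last-step-◅ r rs

module _ {n : ℕ} (H : Bigraph n) where
  open Bigraph H

  edge-sym : ∀ {x y} → E H x y → E H y x
  edge-sym = adj-sym _ _

  non-edge-sym : ∀ {x y} → ¬ E H x y → ¬ E H y x
  non-edge-sym ¬xy yx = ¬xy (edge-sym yx)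

  edge-colours : ∀ {x y} → E H x y → col x ≢ col y
  edge-colours = bipartite _ _

  same-colour-non-edge : ∀ {x y} → col x ≡ col y → ¬ E H x y
  same-colour-non-edge cxy xy = edge-colours xy cxy

  left-arc : ∀ {u v u'} → col u ≡ col v → E H u u' → ¬ E H v u' →
             Arc H (u , v) (u' , v)
  left-arc {u} {v} {u'} cuv uu' ¬vu' = left u≢v u'≢v cuv uu' ¬vu'
    where
      u≢v : u ≢ v
      u≢v refl = ¬vu' uu'
      u'≢v : u' ≢ v
      u'≢v refl = edge-colours uu' cuv

  right-arc : ∀ {u v v'} → col u ≢ col v → E H v v' → ¬ E H u v →
              Arc H (u , v) (u , v')
  right-arc {u} {v} {v'} cuv vv' ¬uv = right u≢v u≢v' cuv vv' ¬uv
    where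
      u≢v : u ≢ v
      u≢v u≡v = cuv (cong col u≡v)
      u≢v' : u ≢ v'
      u≢v' refl = ¬uv (edge-sym vv')

  four-cycle : ∀ {p₀ p₁ p₂ p₃} →
    Arc H p₀ p₁ → Arc H p₁ p₂ → Arc H p₂ p₃ → Arc H p₃ p₀ →
    SameComp H p₀ p₁ × SameComp H p₀ p₂ × SameComp H p₀ p₃
  four-cycle a b c d =
      (a ◅ ε , b ◅ c ◅ d ◅ ε)
    , (a ◅ b ◅ ε , c ◅ d ◅ ε)
    , (a ◅ b ◅ c ◅ ε , d ◅ ε)

  Square : Fin n → Fin n → Fin n → Fin n → Set
  Square u v u' v' = SameComp H (u , v) (u , v)
                   × SameComp H (u , v) (u , v')
                   × SameComp H (u , v) (u' , v)
                   × SameComp H (u , v) (u' , v')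

  square-same-colour : ∀ {u v u' v'} → col u ≡ col v →
                       Independent H u u' v v' → Square u v u' v'
  square-same-colour {u} {v} {u'} {v'} cuv (uu' , vv' , _ , ¬uv' , ¬u'v , _)
    with four-cycle (left-arc  cuv uu' (non-edge-sym ¬u'v))
                    (right-arc cu'≢cv vv' ¬u'v)
                    (left-arc  cu'≡cv' (edge-sym uu') (non-edge-sym ¬uv'))
                    (right-arc cu≢cv' (edge-sym vv') ¬uv')
    where
      cu'≢cu : col u' ≢ col u
      cu'≢cu = edge-colours (edge-sym uu')
      cv'≢cu : col v' ≢ col u
      cv'≢cu c = edge-colours (edge-sym vv') (trans c cuv)
      cu'≢cv : col u' ≢ col v
      cu'≢cv c = cu'≢cu (trans c (sym cuv))
      cu'≡cv' : col u' ≡ col v'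
      cu'≡cv' = two-colours cu'≢cu cv'≢cu
      cu≢cv' : col u ≢ col v'
      cu≢cv' c = cv'≢cu (sym c)
  ... | to-u'v , to-u'v' , to-uv' = (ε , ε) , to-uv' , to-u'v , to-u'v'

  square-different-colour : ∀ {u v u' v'} → col u ≢ col v →
                            Independent H u u' v v' → Square u v u' v'
  square-different-colour {u} {v} {u'} {v'} cu≢cv (uu' , vv' , ¬uv , _ , _ , ¬u'v')
    with four-cycle (right-arc cu≢cv vv' ¬uv)
                    (left-arc  cu≡cv' uu' (non-edge-sym ¬u'v'))
                    (right-arc cu'≢cv' (edge-sym vv') ¬u'v')
                    (left-arc  cu'≡cv (edge-sym uu') (non-edge-sym ¬uv))
    where
      cu'≢cu : col u' ≢ col u
      cu'≢cu = edge-colours (edge-sym uu')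
      cu≡cv' : col u ≡ col v'
      cu≡cv' = two-colours cu≢cv (edge-colours (edge-sym vv'))
      cu'≢cv' : col u' ≢ col v'
      cu'≢cv' c = cu'≢cu (trans c (sym cu≡cv'))
      cu'≡cv : col u' ≡ col v
      cu'≡cv = two-colours cu'≢cu (λ c → cu≢cv (sym c))
  ... | to-uv' , to-u'v' , to-u'v = (ε , ε) , to-uv' , to-u'v , to-u'v'

  independent⇒square : ∀ {u v u' v'} → Independent H u u' v v' → Square u v u' v'
  independent⇒square {u} {v} independent with col u ≟ col v
  ... | yes cu≡cv = square-same-colour cu≡cv independent
  ... | no  cu≢cv = square-different-colour cu≢cv independent

  closed-walk⇒independent : ∀ {u v z} → Reach H (u , v) z → Arc H z (u , v) →
                            ∃₂ λ u' v' → Independent H u u' v v'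
  closed-walk⇒independent {u} {v} walk (right {v = w} u≢w w≢v cuw wv ¬uw)
    with first-step walk (right u≢w w≢v cuw wv ¬uw)
  ... | _ , right _ _ cuv _ _ = ⊥-elim (cuv (two-colours cuw (λ c → edge-colours wv (sym c))))
  ... | _ , left {u' = u₁} _ _ cuv uu₁ ¬vu₁ =
    u₁ , w , uu₁ , edge-sym wv , same-colour-non-edge cuv , ¬uw , non-edge-sym ¬vu₁ ,
    same-colour-non-edge (two-colours (edge-colours (edge-sym uu₁)) (λ c → cuw (sym c)))
  closed-walk⇒independent {u} {v} walk (left {u = w} _ _ cwv wu ¬vu)
    with last-step walk distinct
    where
      distinct : (u , v) ≢ (w , v)
      distinct refl = adj-irr u wu
  ... | _ , _ , left _ _ cxv xw _ = ⊥-elim (edge-colours xw (trans cxv (sym cwv)))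
  ... | _ , _ , right {v = x} _ _ cwx xv ¬wx =
    w , x , edge-sym wu , edge-sym xv , non-edge-sym ¬vu ,
    same-colour-non-edge (two-colours (edge-colours (edge-sym wu)) (λ c → cwx (sym c))) ,
    same-colour-non-edge cwv , ¬wx

  nontrivial⇒independent : ∀ {u v} → NontrivialComp H (u , v) →
                           ∃₂ λ u' v' → Independent H u u' v v'
  nontrivial⇒independent (_ , _ , _ , q≢p , to-q , from-q) with last-step from-q q≢p
  ... | _ , to-z , arc = closed-walk⇒independent (to-q ◅◅ to-z) arc

lemma2p5 : ∀ {n} (H : Bigraph n) → Connected H →
    ∀ (u v : Fin n) → NontrivialComp H (u , v) →
    ∃₂ λ u' v' → Independent H u u' v v'
    × SameComp H (u , v) (u , v)
    × SameComp H (u , v) (u , v')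
    × SameComp H (u , v) (u' , v)
    × SameComp H (u , v) (u' , v')
lemma2p5 H _ u v nontrivial with nontrivial⇒independent H nontrivial
... | u' , v' , independent = u' , v' , independent , independent⇒square H independent
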